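{- Let $C$ be the Gentzen calculus consisting of Cut, Weakening, Contraction, and the elimination rules for all connectives and constants. Then the Identity rule is antiadmissible in $C$: for every set $S$ of sequents, if the empty sequent $\emptyset\vartriangleright\emptyset$ is derivable from $S$ in $C$ extended by Identity, then it is derivable from $S$ in $C$.
   Context: Formulas are built from atoms using $\wedge,\vee,{ - },\top,\bot$; a sequent $\Gamma\vartriangleright\Delta$ is a pair of finite multisets of formulas. Elimination rules: from $\Gamma\vartriangleright\Delta,\varphi\wedge\psi$ infer $\Gamma\vartriangleright\Delta,\varphi$, and infer $\Gamma\vartriangleright\Delta,\psi$; from $\varphi\wedge\psi,\Gamma\vartriangleright\Delta$ infer $\varphi,\psi,\Gamma\vartriangleright\Delta$; from $\varphi\vee\psi,\Gamma\vartriangleright\Delta$ infer $\varphi,\Gamma\vartriangleright\Delta$, and infer $\psi,\Gamma\vartriangleright\Delta$; from $\Gamma\vartriangleright\Delta,\varphi\vee\psi$ infer $\Gamma\vartriangleright\Delta,\varphi,\psi$; from $\Gamma\vartriangleright\Delta,{ - }\varphi$ infer $\varphi,\Gamma\vartriangleright\Delta$; from ${ - }\varphi,\Gamma\vartriangleright\Delta$ infer $\Gamma\vartriangleright\Delta,\varphi$; from $\top,\Gamma\vartriangleright\Delta$ infer $\Gamma\vartriangleright\Delta$; from $\Gamma\vartriangleright\Delta,\bot$ infer $\Gamma\vartriangleright\Delta$. Weakening: from $\Gamma\vartriangleright\Delta$ infer $\varphi,\Gamma\vartriangleright\Delta$ and $\Gamma\vartriangleright\Delta,\varphi$. Contraction: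 from $\varphi,\varphi,\Gamma\vartriangleright\Delta$ infer $\varphi,\Gamma\vartriangleright\Delta$; from $\Gamma\vartriangleright\Delta,\varphi,\varphi$ infer $\Gamma\vartriangleright\Delta,\varphi$. Cut: from $\Gamma\vartriangleright\Delta,\varphi$ and $\varphi,\Gamma'\vartriangleright\Delta'$ infer $\Gamma,\Gamma'\vartriangleright\Delta,\Delta'$. Identity: the axiom $\varphi\vartriangleright\varphi$. All rules apply to arbitrary formulas and finite multisets. -}

module Defs where

open import Data.Nat using (ℕ)
open import Data.Bool using (Bool; true; false)
open import Data.List using (List; []; _∷_; _++_)
open import Data.List.Relation.Binary.Permutation.Propositional using (_↭_)
open import Relation.Binary.PropositionalEquality using (_≡_)

data Formula : Set where
  atom : ℕ → Formula
  _∧′_ : Formula → Formula → Formula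
  _∨′_ : Formula → Formula → Formula
  -′_  : Formula → Formula
  ⊤′   : Formula
  ⊥′   : Formula

-- A sequent Γ ▷ Δ : a pair of finite multisets of formulas.
-- Multisets are represented by lists taken up to permutation
-- (see the rule `perm` below, and `_≈ₛ_`).
record Sequent : Set where
  constructor _▷_
  field
    ante : List Formula
    succ : List Formula

open Sequent public

SequentSet : Set₁
SequentSet = Sequent → Set

data _⊢[_]_ (S : SequentSet) (withId : Bool) : Sequent → Set where
  hyp   : ∀ {s} → S s → S ⊢[ withId ] s
  perm  : ∀ {Γ Γ′ Δ Δ′} → Γ ↭ Γ′ → Δ ↭ Δ′ →
          S ⊢[ withId ] (Γ ▷ Δ) → S ⊢[ withId ] (Γ′ ▷ Δ′)
  ident : ∀ {φ} → withId ≡ true → S ⊢[ withId ] ((φ ∷ []) ▷ (φ ∷ []))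
  cut   : ∀ {Γ Δ Γ′ Δ′ φ} →
          S ⊢[ withId ] (Γ ▷ (Δ ++ (φ ∷ []))) →
          S ⊢[ withId ] ((φ ∷ Γ′) ▷ Δ′) →
          S ⊢[ withId ] ((Γ ++ Γ′) ▷ (Δ ++ Δ′))
  weakL : ∀ {Γ Δ φ} → S ⊢[ withId ] (Γ ▷ Δ) → S ⊢[ withId ] ((φ ∷ Γ) ▷ Δ)
  weakR : ∀ {Γ Δ φ} → S ⊢[ withId ] (Γ ▷ Δ) → S ⊢[ withId ] (Γ ▷ (Δ ++ (φ ∷ [])))
  contrL : ∀ {Γ Δ φ} → S ⊢[ withId ] ((φ ∷ φ ∷ Γ) ▷ Δ) → S ⊢[ withId ] ((φ ∷ Γ) ▷ Δ)
  contrR : ∀ {Γ Δ φ} → S ⊢[ withId ] (Γ ▷ (Δ ++ (φ ∷ φ ∷ []))) →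
           S ⊢[ withId ] (Γ ▷ (Δ ++ (φ ∷ [])))
  ∧R-elim₁ : ∀ {Γ Δ φ ψ} → S ⊢[ withId ] (Γ ▷ (Δ ++ ((φ ∧′ ψ) ∷ []))) →
             S ⊢[ withId ] (Γ ▷ (Δ ++ (φ ∷ [])))
  ∧R-elim₂ : ∀ {Γ Δ φ ψ} → S ⊢[ withId ] (Γ ▷ (Δ ++ ((φ ∧′ ψ) ∷ []))) →
             S ⊢[ withId ] (Γ ▷ (Δ ++ (ψ ∷ [])))
  ∧L-elim  : ∀ {Γ Δ φ ψ} → S ⊢[ withId ] (((φ ∧′ ψ) ∷ Γ) ▷ Δ) →
             S ⊢[ withId ] ((φ ∷ ψ ∷ Γ) ▷ Δ)
  ∨L-elim₁ : ∀ {Γ Δ φ ψ} → S ⊢[ withId ] (((φ ∨′ ψ) ∷ Γ) ▷ Δ) →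
             S ⊢[ withId ] ((φ ∷ Γ) ▷ Δ)
  ∨L-elim₂ : ∀ {Γ Δ φ ψ} → S ⊢[ withId ] (((φ ∨′ ψ) ∷ Γ) ▷ Δ) →
             S ⊢[ withId ] ((ψ ∷ Γ) ▷ Δ)
  ∨R-elim  : ∀ {Γ Δ φ ψ} → S ⊢[ withId ] (Γ ▷ (Δ ++ ((φ ∨′ ψ) ∷ []))) →
             S ⊢[ withId ] (Γ ▷ (Δ ++ (φ ∷ ψ ∷ [])))
  -R-elim  : ∀ {Γ Δ φ} → S ⊢[ withId ] (Γ ▷ (Δ ++ ((-′ φ) ∷ []))) →
             S ⊢[ withId ] ((φ ∷ Γ) ▷ Δ)
  -L-elim  : ∀ {Γ Δ φ} → S ⊢[ withId ] (((-′ φ) ∷ Γ) ▷ Δ) →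
             S ⊢[ withId ] (Γ ▷ (Δ ++ (φ ∷ [])))
  ⊤L-elim  : ∀ {Γ Δ} → S ⊢[ withId ] ((⊤′ ∷ Γ) ▷ Δ) → S ⊢[ withId ] (Γ ▷ Δ)
  ⊥R-elim  : ∀ {Γ Δ} → S ⊢[ withId ] (Γ ▷ (Δ ++ (⊥′ ∷ []))) → S ⊢[ withId ] (Γ ▷ Δ)

-- Decompose each formula by the elimination rules down to atoms: a left (right)
-- leaf of φ is a sequent so obtained from φ ▷ ∅ (∅ ▷ φ), choosing a branch at
-- every ∨ on the left and every ∧ on the right.  Call a sequent closed if it is
-- derivable without Identity or axiomatic (some formula occurs on both sides),
-- and good if every choice of leaves for its formulas combines into a closed
-- sequent.  Everything derivable with Identity is good: a hypothesis because
-- the elimination rules derive its leaves, Identity because the leaves of φ on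
-- the two sides meet, the structural and elimination rules because they only
-- regroup leaves, and Cut by induction on the cut formula, which leaves only
-- cuts on atoms between closed sequents.  The empty sequent has the single
-- leaf ∅ ▷ ∅, which is not axiomatic, so it is derivable without Identity.

module Submission where

open import Defs
open import Data.Bool using (Bool; true; false)
open import Data.List using (List; []; _∷_; _++_; [_])
open import Data.List.Properties using (++-assoc)
open import Data.List.Membership.Propositional using (_∈_)
open import Data.List.Membership.Propositional.Properties using (∈-++⁻; ∈-∃++)
open import Data.List.Relation.Unary.Any using (here; there)
open import Data.List.Relation.Binary.Subset.Propositional using (_⊆_)
open import Data.List.Relation.Binary.Subset.Propositional.Properties
  using (⊆-refl; ⊆-reflexive; xs⊆xs++ys; xs⊆ys++xs; ∈-∷⁺ʳ; ++⁺)
open import Data.List.Relation.Binary.Permutation.Propositional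
  using (_↭_; ↭-refl; ↭-sym; ↭-prep; module _↭_)
open import Data.List.Relation.Binary.Permutation.Propositional.Properties
  using (shift; ++-comm)
open import Data.Product using (∃-syntax; ∃₂; _×_; _,_)
open import Data.Sum using (_⊎_; inj₁; inj₂; [_,_]′)
open import Function using (_∘_)
open import Relation.Binary.PropositionalEquality using (refl; sym)

private variable
  S : SequentSet
  b : Bool
  φ ψ : Formula
  Γ Γ′ Δ Δ′ : List Formula
  s s′ t u : Sequent

infixl 6 _⊕_
infix 4 _⊆ˢ_
infixr 5 _⨾_

_⊕_ : Sequent → Sequent → Sequent
s ⊕ t = (ante s ++ ante t) ▷ (succ s ++ succ t)

∅ : Sequent
∅ = [] ▷ []

left right : Formula → Sequent
left φ = (φ ∷ []) ▷ []
right φ = [] ▷ (φ ∷ [])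

-- With Weakening and Contraction, derivability depends only on the sets of
-- formulas on each side (⊢-mono), so sequents are compared by set inclusion.
_⊆ˢ_ : Sequent → Sequent → Set
s ⊆ˢ s′ = ante s ⊆ ante s′ × succ s ⊆ succ s′

⊆ˢ-refl : s ⊆ˢ s
⊆ˢ-refl = ⊆-refl , ⊆-refl

_⨾_ : ∀ {a b c} → a ⊆ˢ b → b ⊆ˢ c → a ⊆ˢ c
(f , g) ⨾ (h , k) = h ∘ f , k ∘ g

∅⊆ˢ : ∅ ⊆ˢ s
∅⊆ˢ = (λ ()) , (λ ())

a⊆ˢa⊕b : ∀ a b → a ⊆ˢ a ⊕ b
a⊆ˢa⊕b a b = xs⊆xs++ys (ante a) (ante b) , xs⊆xs++ys (succ a) (succ b)

b⊆ˢa⊕b : ∀ a b → b ⊆ˢ a ⊕ b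
b⊆ˢa⊕b a b = xs⊆ys++xs (ante b) (ante a) , xs⊆ys++xs (succ b) (succ a)

⊕-lub : ∀ a {b c} → a ⊆ˢ c → b ⊆ˢ c → a ⊕ b ⊆ˢ c
⊕-lub a (f , g) (h , k) =
  (λ m → [ f , h ]′ (∈-++⁻ (ante a) m)) , (λ m → [ g , k ]′ (∈-++⁻ (succ a) m))

⊕-mono : ∀ {a a′ b b′} → a ⊆ˢ a′ → b ⊆ˢ b′ → a ⊕ b ⊆ˢ a′ ⊕ b′
⊕-mono (f , g) (h , k) = ++⁺ f h , ++⁺ g k

⊕-monoˡ : ∀ {a a′} c → a ⊆ˢ a′ → a ⊕ c ⊆ˢ a′ ⊕ c
⊕-monoˡ c a⊆a′ = ⊕-mono a⊆a′ (⊆ˢ-refl {c})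

⊕-monoʳ : ∀ {b b′} c → b ⊆ˢ b′ → c ⊕ b ⊆ˢ c ⊕ b′
⊕-monoʳ c = ⊕-mono (⊆ˢ-refl {c})

⊕-comm : ∀ a b → a ⊕ b ⊆ˢ b ⊕ a
⊕-comm a b = ⊕-lub a (b⊆ˢa⊕b b a) (a⊆ˢa⊕b b a)

⊕-assocˡ : ∀ a b c → a ⊕ (b ⊕ c) ⊆ˢ (a ⊕ b) ⊕ c
⊕-assocˡ a b c =
  ⊆-reflexive (sym (++-assoc (ante a) (ante b) (ante c))) ,
  ⊆-reflexive (sym (++-assoc (succ a) (succ b) (succ c)))

⊕-assocʳ : ∀ a b c → (a ⊕ b) ⊕ c ⊆ˢ a ⊕ (b ⊕ c)
⊕-assocʳ a b c =
  ⊆-reflexive (++-assoc (ante a) (ante b) (ante c)) ,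
  ⊆-reflexive (++-assoc (succ a) (succ b) (succ c))

⊕-swap : ∀ a b c → a ⊕ (b ⊕ c) ⊆ˢ b ⊕ (a ⊕ c)
⊕-swap a b c = ⊕-assocˡ a b c ⨾ ⊕-monoˡ c (⊕-comm a b) ⨾ ⊕-assocʳ b a c

⊕-rotate : ∀ a b c → b ⊕ (a ⊕ c) ⊆ˢ (a ⊕ b) ⊕ c
⊕-rotate a b c = ⊕-swap b a c ⨾ ⊕-assocˡ a b c

⊕-idem : ∀ a c → a ⊕ (a ⊕ c) ⊆ˢ a ⊕ c
⊕-idem a c = ⊕-lub a (a⊆ˢa⊕b a c) ⊆ˢ-refl

⊕-interchange : ∀ a b c d → (a ⊕ b) ⊕ (c ⊕ d) ⊆ˢ (a ⊕ c) ⊕ (b ⊕ d)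
⊕-interchange a b c d =
  ⊕-lub (a ⊕ b) (⊕-mono (a⊆ˢa⊕b a c) (a⊆ˢa⊕b b d)) (⊕-mono (b⊆ˢa⊕b a c) (b⊆ˢa⊕b b d))

⊢-permL : Γ ↭ Γ′ → S ⊢[ b ] (Γ ▷ Δ) → S ⊢[ b ] (Γ′ ▷ Δ)
⊢-permL Γ↭Γ′ = perm Γ↭Γ′ ↭-refl

⊢-permR : Δ ↭ Δ′ → S ⊢[ b ] (Γ ▷ Δ) → S ⊢[ b ] (Γ ▷ Δ′)
⊢-permR = perm ↭-refl

⊢-++-commR : ∀ Δ Δ′ → S ⊢[ b ] (Γ ▷ (Δ ++ Δ′)) → S ⊢[ b ] (Γ ▷ (Δ′ ++ Δ))
⊢-++-commR Δ Δ′ = ⊢-permR (++-comm Δ Δ′)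

weakR′ : S ⊢[ b ] (Γ ▷ Δ) → S ⊢[ b ] (Γ ▷ (φ ∷ Δ))
weakR′ {Δ = Δ} {φ = φ} d = ⊢-++-commR Δ [ φ ] (weakR d)

contrR′ : S ⊢[ b ] (Γ ▷ (φ ∷ φ ∷ Δ)) → S ⊢[ b ] (Γ ▷ (φ ∷ Δ))
contrR′ {φ = φ} {Δ = Δ} d =
  ⊢-++-commR Δ [ φ ] (contrR (⊢-++-commR (φ ∷ φ ∷ []) Δ d))

weakenL++ : ∀ Γ′ → S ⊢[ b ] (Γ ▷ Δ) → S ⊢[ b ] ((Γ′ ++ Γ) ▷ Δ)
weakenL++ []       d = d
weakenL++ (_ ∷ Γ′) d = weakL (weakenL++ Γ′ d)

weakenR++ : ∀ Δ′ → S ⊢[ b ] (Γ ▷ Δ) → S ⊢[ b ] (Γ ▷ (Δ′ ++ Δ))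
weakenR++ []       d = d
weakenR++ (_ ∷ Δ′) d = weakR′ (weakenR++ Δ′ d)

contract∈L : φ ∈ Γ → S ⊢[ b ] ((φ ∷ Γ) ▷ Δ) → S ⊢[ b ] (Γ ▷ Δ)
contract∈L {φ = φ} φ∈Γ d with ys , zs , refl ← ∈-∃++ φ∈Γ =
  ⊢-permL (↭-sym (shift φ ys zs)) (contrL (⊢-permL (↭-prep φ (shift φ ys zs)) d))

contract∈R : φ ∈ Δ → S ⊢[ b ] (Γ ▷ (φ ∷ Δ)) → S ⊢[ b ] (Γ ▷ Δ)
contract∈R {φ = φ} φ∈Δ d with ys , zs , refl ← ∈-∃++ φ∈Δ =
  ⊢-permR (↭-sym (shift φ ys zs)) (contrR′ (⊢-permR (↭-prep φ (shift φ ys zs)) d))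

contract⊆L : ∀ Γ′ → Γ′ ⊆ Γ → S ⊢[ b ] ((Γ′ ++ Γ) ▷ Δ) → S ⊢[ b ] (Γ ▷ Δ)
contract⊆L []       _    d = d
contract⊆L (φ ∷ Γ′) Γ′⊆Γ d =
  contract⊆L Γ′ (Γ′⊆Γ ∘ there) (contract∈L (xs⊆ys++xs _ Γ′ (Γ′⊆Γ (here refl))) d)

contract⊆R : ∀ Δ′ → Δ′ ⊆ Δ → S ⊢[ b ] (Γ ▷ (Δ′ ++ Δ)) → S ⊢[ b ] (Γ ▷ Δ)
contract⊆R []       _    d = d
contract⊆R (φ ∷ Δ′) Δ′⊆Δ d =
  contract⊆R Δ′ (Δ′⊆Δ ∘ there) (contract∈R (xs⊆ys++xs _ Δ′ (Δ′⊆Δ (here refl))) d)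

⊢-mono : S ⊢[ b ] s → s ⊆ˢ s′ → S ⊢[ b ] s′
⊢-mono {s = Γ ▷ Δ} {s′ = Γ′ ▷ Δ′} d (Γ⊆Γ′ , Δ⊆Δ′) =
  contract⊆R Δ Δ⊆Δ′ (⊢-++-commR Δ′ Δ (weakenR++ Δ′
    (contract⊆L Γ Γ⊆Γ′ (⊢-permL (++-comm Γ′ Γ) (weakenL++ Γ′ d)))))

data LeftLeaf : Formula → Sequent → Set
data RightLeaf : Formula → Sequent → Set

-- ⊥ on the left and ⊤ on the right have no elimination rule; their leaf also
-- carries the constant on the other side (a weakening), so that the leaves of
-- ⊥ ▷ ⊥ and ⊤ ▷ ⊤ are axiomatic.
data LeftLeaf where
  atomˡ : ∀ n → LeftLeaf (atom n) (left (atom n))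
  ∧ˡ    : LeftLeaf φ t → LeftLeaf ψ u → LeftLeaf (φ ∧′ ψ) (t ⊕ u)
  ∨ˡ₁   : LeftLeaf φ t → LeftLeaf (φ ∨′ ψ) t
  ∨ˡ₂   : LeftLeaf ψ t → LeftLeaf (φ ∨′ ψ) t
  -ˡ    : RightLeaf φ t → LeftLeaf (-′ φ) t
  ⊤ˡ    : LeftLeaf ⊤′ ∅
  ⊥ˡ    : LeftLeaf ⊥′ (left ⊥′ ⊕ right ⊥′)

data RightLeaf where
  atomʳ : ∀ n → RightLeaf (atom n) (right (atom n))
  ∧ʳ₁   : RightLeaf φ t → RightLeaf (φ ∧′ ψ) t
  ∧ʳ₂   : RightLeaf ψ t → RightLeaf (φ ∧′ ψ) t
  ∨ʳ    : RightLeaf φ t → RightLeaf ψ u → RightLeaf (φ ∨′ ψ) (t ⊕ u)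
  -ʳ    : LeftLeaf φ t → RightLeaf (-′ φ) t
  ⊤ʳ    : RightLeaf ⊤′ (left ⊤′ ⊕ right ⊤′)
  ⊥ʳ    : RightLeaf ⊥′ ∅

data Leaves (Leaf : Formula → Sequent → Set) : List Formula → Sequent → Set where
  []  : Leaves Leaf [] ∅
  _∷_ : Leaf φ t → Leaves Leaf Γ u → Leaves Leaf (φ ∷ Γ) (t ⊕ u)

module _ {Leaf : Formula → Sequent → Set} where

  leaves-++⁻ : ∀ Γ → Leaves Leaf (Γ ++ Γ′) t →
    ∃₂ λ t₁ t₂ → Leaves Leaf Γ t₁ × Leaves Leaf Γ′ t₂ × t₁ ⊕ t₂ ⊆ˢ t
  leaves-++⁻ []      ls = ∅ , _ , [] , ls , ⊆ˢ-refl
  leaves-++⁻ (_ ∷ Γ) (_∷_ {t = v} l ls) with leaves-++⁻ Γ ls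
  ... | t₁ , t₂ , ls₁ , ls₂ , t₁⊕t₂⊆t =
    v ⊕ t₁ , t₂ , l ∷ ls₁ , ls₂ , ⊕-assocʳ v t₁ t₂ ⨾ ⊕-monoʳ v t₁⊕t₂⊆t

  leaves-↭ : Γ ↭ Γ′ → Leaves Leaf Γ′ t → ∃[ t′ ] Leaves Leaf Γ t′ × t′ ⊆ˢ t
  leaves-↭ _↭_.refl ls = _ , ls , ⊆ˢ-refl
  leaves-↭ (_↭_.prep _ p) (_∷_ {t = v} l ls) with leaves-↭ p ls
  ... | t′ , ls′ , t′⊆t = v ⊕ t′ , l ∷ ls′ , ⊕-monoʳ v t′⊆t
  leaves-↭ (_↭_.swap _ _ p) (_∷_ {t = v₂} l₂ (_∷_ {t = v₁} l₁ ls)) with leaves-↭ p ls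
  ... | t′ , ls′ , t′⊆t =
    v₁ ⊕ (v₂ ⊕ t′) , l₁ ∷ (l₂ ∷ ls′) , ⊕-swap v₁ v₂ t′ ⨾ ⊕-monoʳ v₂ (⊕-monoʳ v₁ t′⊆t)
  leaves-↭ (_↭_.trans p q) ls with leaves-↭ q ls
  ... | t″ , ls″ , t″⊆t with leaves-↭ p ls″
  ... | t′ , ls′ , t′⊆t″ = t′ , ls′ , t′⊆t″ ⨾ t″⊆t

eliminateL : S ⊢[ b ] ((φ ∷ Γ) ▷ Δ) → LeftLeaf φ t → S ⊢[ b ] (t ⊕ (Γ ▷ Δ))
eliminateR : S ⊢[ b ] (Γ ▷ (φ ∷ Δ)) → RightLeaf φ u → S ⊢[ b ] (u ⊕ (Γ ▷ Δ))

eliminateL d (atomˡ n) = d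
eliminateL {Γ = Γ} {Δ = Δ} d (∧ˡ {t = t₁} {ψ = ψ} {u = t₂} l₁ l₂) =
  ⊢-mono (eliminateL (⊢-mono (eliminateL (∧L-elim d) l₁) (⊕-swap t₁ (left ψ) (Γ ▷ Δ))) l₂)
    (⊕-rotate t₁ t₂ (Γ ▷ Δ))
eliminateL d (∨ˡ₁ l) = eliminateL (∨L-elim₁ d) l
eliminateL d (∨ˡ₂ l) = eliminateL (∨L-elim₂ d) l
eliminateL {Δ = Δ} d (-ˡ r) = eliminateR (⊢-++-commR Δ [ _ ] (-L-elim d)) r
eliminateL d ⊤ˡ = ⊤L-elim d
eliminateL d ⊥ˡ = weakR′ d

eliminateR d (atomʳ n) = d
eliminateR {Δ = Δ} d (∧ʳ₁ r) =
  eliminateR (⊢-++-commR Δ [ _ ] (∧R-elim₁ (⊢-++-commR [ _ ] Δ d))) r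
eliminateR {Δ = Δ} d (∧ʳ₂ r) =
  eliminateR (⊢-++-commR Δ [ _ ] (∧R-elim₂ (⊢-++-commR [ _ ] Δ d))) r
eliminateR {Γ = Γ} {Δ = Δ} d (∨ʳ {φ = φ} {t = u₁} {ψ = ψ} {u = u₂} r₁ r₂) =
  ⊢-mono (eliminateR (⊢-mono (eliminateR ∨-split r₁) (⊕-swap u₁ (right ψ) (Γ ▷ Δ))) r₂)
    (⊕-rotate u₁ u₂ (Γ ▷ Δ))
  where
  ∨-split : _ ⊢[ _ ] (Γ ▷ (φ ∷ ψ ∷ Δ))
  ∨-split = ⊢-++-commR Δ (φ ∷ ψ ∷ []) (∨R-elim (⊢-++-commR [ _ ] Δ d))
eliminateR {Δ = Δ} d (-ʳ l) = eliminateL (-R-elim (⊢-++-commR [ _ ] Δ d)) l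
eliminateR d ⊤ʳ = weakL d
eliminateR {Δ = Δ} d ⊥ʳ = ⊥R-elim (⊢-++-commR [ _ ] Δ d)

eliminateLs : ∀ {g} → S ⊢[ b ] ((Γ ▷ []) ⊕ g) → Leaves LeftLeaf Γ t → S ⊢[ b ] (t ⊕ g)
eliminateLs d [] = d
eliminateLs {Γ = _ ∷ Γ} {g = g} d (_∷_ {t = v} {u = t} l ls) =
  ⊢-mono (eliminateLs (⊢-mono (eliminateL d l) (⊕-swap v (Γ ▷ []) g)) ls) (⊕-rotate v t g)

eliminateRs : ∀ {g} → S ⊢[ b ] (([] ▷ Δ) ⊕ g) → Leaves RightLeaf Δ u → S ⊢[ b ] (u ⊕ g)
eliminateRs d [] = d
eliminateRs {Δ = _ ∷ Δ} {g = g} d (_∷_ {t = v} {u = u} r rs) =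
  ⊢-mono (eliminateRs (⊢-mono (eliminateR d r) (⊕-swap v ([] ▷ Δ) g)) rs) (⊕-rotate v u g)

Axiomatic : Sequent → Set
Axiomatic s = ∃[ χ ] χ ∈ ante s × χ ∈ succ s

Closed : SequentSet → Sequent → Set
Closed S s = S ⊢[ false ] s ⊎ Axiomatic s

axiomatic-mono : Axiomatic s → s ⊆ˢ s′ → Axiomatic s′
axiomatic-mono (χ , χ∈Γ , χ∈Δ) (Γ⊆Γ′ , Δ⊆Δ′) = χ , Γ⊆Γ′ χ∈Γ , Δ⊆Δ′ χ∈Δ

closed-mono : Closed S s → s ⊆ˢ s′ → Closed S s′
closed-mono (inj₁ d)  s⊆s′ = inj₁ (⊢-mono d s⊆s′)
closed-mono (inj₂ ax) s⊆s′ = inj₂ (axiomatic-mono ax s⊆s′)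

axiomatic-unconsL : Axiomatic ((φ ∷ Γ) ▷ Δ) → φ ∈ Δ ⊎ Axiomatic (Γ ▷ Δ)
axiomatic-unconsL (_ , here refl , φ∈Δ) = inj₁ φ∈Δ
axiomatic-unconsL (χ , there χ∈Γ , χ∈Δ) = inj₂ (χ , χ∈Γ , χ∈Δ)

axiomatic-unconsR : Axiomatic (Γ ▷ (φ ∷ Δ)) → φ ∈ Γ ⊎ Axiomatic (Γ ▷ Δ)
axiomatic-unconsR (_ , φ∈Γ , here refl) = inj₁ φ∈Γ
axiomatic-unconsR (χ , χ∈Γ , there χ∈Δ) = inj₂ (χ , χ∈Γ , χ∈Δ)

closed-cut : ∀ a c → Closed S (right φ ⊕ a) → Closed S (left φ ⊕ c) → Closed S (a ⊕ c)
closed-cut a c (inj₁ d₁) (inj₁ d₂) = inj₁ (cut (⊢-++-commR [ _ ] (succ a) d₁) d₂)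
closed-cut a c (inj₂ ax₁) closed₂ with axiomatic-unconsR ax₁
... | inj₁ φ∈a =
  closed-mono closed₂ (∈-∷⁺ʳ (xs⊆xs++ys _ (ante c) φ∈a) (xs⊆ys++xs _ (ante a)) , xs⊆ys++xs _ (succ a))
... | inj₂ ax  = inj₂ (axiomatic-mono ax (a⊆ˢa⊕b a c))
closed-cut a c (inj₁ d₁) (inj₂ ax₂) with axiomatic-unconsL ax₂
... | inj₁ φ∈c =
  inj₁ (⊢-mono d₁ (xs⊆xs++ys _ (ante c) , ∈-∷⁺ʳ (xs⊆ys++xs _ (succ a) φ∈c) (xs⊆xs++ys _ (succ c))))
... | inj₂ ax  = inj₂ (axiomatic-mono ax (b⊆ˢa⊕b a c))

-- A left leaf of φ ∧ ψ joins a leaf of each conjunct while a right leaf comes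
-- from one of them, so a cut on φ ∧ ψ is a cut on φ whose left premises are
-- themselves cuts on ψ; dually for ∨, and - swaps the two sides.
closed-cut-leaves : ∀ φ a c →
  (∀ {u} → RightLeaf φ u → Closed S (a ⊕ u)) →
  (∀ {t} → LeftLeaf φ t → Closed S (t ⊕ c)) →
  Closed S (a ⊕ c)
closed-cut-leaves (atom n) a c closedʳ closedˡ =
  closed-cut a c (closed-mono (closedʳ (atomʳ n)) (⊕-comm a _)) (closedˡ (atomˡ n))
closed-cut-leaves (φ ∧′ ψ) a c closedʳ closedˡ =
  closed-mono (closed-cut-leaves φ a (a ⊕ c) (closedʳ ∘ ∧ʳ₁) closed-φ) (⊕-idem a c)
  where
  closed-φ : ∀ {t₁} → LeftLeaf φ t₁ → Closed _ (t₁ ⊕ (a ⊕ c))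
  closed-φ {t₁} l₁ = closed-mono (closed-cut-leaves ψ a (t₁ ⊕ c) (closedʳ ∘ ∧ʳ₂)
    λ {t₂} l₂ → closed-mono (closedˡ (∧ˡ l₁ l₂)) (⊕-assocʳ t₁ t₂ c ⨾ ⊕-swap t₁ t₂ c))
    (⊕-swap a t₁ c)
closed-cut-leaves (φ ∨′ ψ) a c closedʳ closedˡ =
  closed-mono (closed-cut-leaves φ (a ⊕ c) c closed-φ (closedˡ ∘ ∨ˡ₁))
    (⊕-assocʳ a c c ⨾ ⊕-monoʳ a (⊕-lub c ⊆ˢ-refl ⊆ˢ-refl))
  where
  closed-φ : ∀ {u₁} → RightLeaf φ u₁ → Closed _ ((a ⊕ c) ⊕ u₁)
  closed-φ {u₁} r₁ = closed-mono (closed-cut-leaves ψ (a ⊕ u₁) c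
    (λ {u₂} r₂ → closed-mono (closedʳ (∨ʳ r₁ r₂)) (⊕-assocˡ a u₁ u₂)) (closedˡ ∘ ∨ˡ₂))
    (⊕-assocʳ a u₁ c ⨾ ⊕-monoʳ a (⊕-comm u₁ c) ⨾ ⊕-assocˡ a c u₁)
closed-cut-leaves (-′ φ) a c closedʳ closedˡ =
  closed-mono (closed-cut-leaves φ c a
      (λ {u} r → closed-mono (closedˡ (-ˡ r)) (⊕-comm u c))
      (λ {t} l → closed-mono (closedʳ (-ʳ l)) (⊕-comm a t)))
    (⊕-comm c a)
closed-cut-leaves ⊤′ a c closedʳ closedˡ = closed-mono (closedˡ ⊤ˡ) (b⊆ˢa⊕b a c)
closed-cut-leaves ⊥′ a c closedʳ closedˡ = closed-mono (closedʳ ⊥ʳ) (⊕-monoʳ a ∅⊆ˢ)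

identity-leaves-axiomatic : LeftLeaf φ t → RightLeaf φ u → Axiomatic (t ⊕ u)
identity-leaves-axiomatic (atomˡ n) (atomʳ n) = atom n , here refl , here refl
identity-leaves-axiomatic (∧ˡ {t = t₁} {u = t₂} l₁ l₂) (∧ʳ₁ {t = u} r) =
  axiomatic-mono (identity-leaves-axiomatic l₁ r) (⊕-monoˡ u (a⊆ˢa⊕b t₁ t₂))
identity-leaves-axiomatic (∧ˡ {t = t₁} {u = t₂} l₁ l₂) (∧ʳ₂ {t = u} r) =
  axiomatic-mono (identity-leaves-axiomatic l₂ r) (⊕-monoˡ u (b⊆ˢa⊕b t₁ t₂))
identity-leaves-axiomatic {t = t} (∨ˡ₁ l) (∨ʳ {t = u₁} {u = u₂} r₁ r₂) =
  axiomatic-mono (identity-leaves-axiomatic l r₁) (⊕-monoʳ t (a⊆ˢa⊕b u₁ u₂))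
identity-leaves-axiomatic {t = t} (∨ˡ₂ l) (∨ʳ {t = u₁} {u = u₂} r₁ r₂) =
  axiomatic-mono (identity-leaves-axiomatic l r₂) (⊕-monoʳ t (b⊆ˢa⊕b u₁ u₂))
identity-leaves-axiomatic {t = t} {u = u} (-ˡ r) (-ʳ l) =
  axiomatic-mono (identity-leaves-axiomatic l r) (⊕-comm u t)
identity-leaves-axiomatic ⊤ˡ ⊤ʳ = ⊤′ , here refl , here refl
identity-leaves-axiomatic ⊥ˡ ⊥ʳ = ⊥′ , here refl , here refl

Good : SequentSet → Sequent → Set
Good S s = ∀ {t u} → Leaves LeftLeaf (ante s) t → Leaves RightLeaf (succ s) u → Closed S (t ⊕ u)

derivable⇒good : S ⊢[ false ] s → Good S s
derivable⇒good {s = Γ ▷ Δ} d {t} {u} ls rs =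
  inj₁ (⊢-mono (eliminateRs (⊢-mono (eliminateLs d′ ls) (⊕-comm t ([] ▷ Δ))) rs) (⊕-comm u t))
  where
  d′ : _ ⊢[ false ] ((Γ ▷ []) ⊕ ([] ▷ Δ))
  d′ = ⊢-mono d (xs⊆xs++ys Γ [] , ⊆-refl)

good-↭ : Γ ↭ Γ′ → Δ ↭ Δ′ → Good S (Γ ▷ Δ) → Good S (Γ′ ▷ Δ′)
good-↭ Γ↭Γ′ Δ↭Δ′ good ls rs with leaves-↭ Γ↭Γ′ ls | leaves-↭ Δ↭Δ′ rs
... | _ , ls′ , t′⊆t | _ , rs′ , u′⊆u = closed-mono (good ls′ rs′) (⊕-mono t′⊆t u′⊆u)

good-++-commR : ∀ Δ Δ′ → Good S (Γ ▷ (Δ ++ Δ′)) → Good S (Γ ▷ (Δ′ ++ Δ))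
good-++-commR Δ Δ′ = good-↭ ↭-refl (++-comm Δ Δ′)

good-identity : Good S ((φ ∷ []) ▷ (φ ∷ []))
good-identity (_∷_ {t = t} l []) (_∷_ {t = u} r []) =
  inj₂ (axiomatic-mono (identity-leaves-axiomatic l r) (⊕-mono (a⊆ˢa⊕b t ∅) (a⊆ˢa⊕b u ∅)))

good-cut : Good S (Γ ▷ (φ ∷ Δ)) → Good S ((φ ∷ Γ′) ▷ Δ′) → Good S ((Γ ++ Γ′) ▷ (Δ ++ Δ′))
good-cut {Γ = Γ} {φ = φ} {Δ = Δ} good₁ good₂ ls rs
  with leaves-++⁻ Γ ls | leaves-++⁻ Δ rs
... | t₁ , t₂ , ls₁ , ls₂ , t₁⊕t₂⊆t | u₁ , u₂ , rs₁ , rs₂ , u₁⊕u₂⊆u =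
  closed-mono (closed-cut-leaves φ (t₁ ⊕ u₁) (t₂ ⊕ u₂)
      (λ {v} r → closed-mono (good₁ ls₁ (r ∷ rs₁))
        (⊕-monoʳ t₁ (⊕-comm v u₁) ⨾ ⊕-assocˡ t₁ u₁ v))
      (λ {w} l → closed-mono (good₂ (l ∷ ls₂) rs₂) (⊕-assocʳ w t₂ u₂)))
    (⊕-interchange t₁ u₁ t₂ u₂ ⨾ ⊕-mono t₁⊕t₂⊆t u₁⊕u₂⊆u)

good-weakL : Good S (Γ ▷ Δ) → Good S ((φ ∷ Γ) ▷ Δ)
good-weakL good {u = u} (_∷_ {t = v} {u = t} _ ls) rs =
  closed-mono (good ls rs) (⊕-monoˡ u (b⊆ˢa⊕b v t))

good-weakR : Good S (Γ ▷ Δ) → Good S (Γ ▷ (φ ∷ Δ))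
good-weakR good {t = t} ls (_∷_ {t = v} {u = u} _ rs) =
  closed-mono (good ls rs) (⊕-monoʳ t (b⊆ˢa⊕b v u))

good-contrL : Good S ((φ ∷ φ ∷ Γ) ▷ Δ) → Good S ((φ ∷ Γ) ▷ Δ)
good-contrL good {u = u} (_∷_ {t = v} {u = t} l ls) rs =
  closed-mono (good (l ∷ l ∷ ls) rs) (⊕-monoˡ u (⊕-idem v t))

good-contrR : Good S (Γ ▷ (φ ∷ φ ∷ Δ)) → Good S (Γ ▷ (φ ∷ Δ))
good-contrR good {t = t} ls (_∷_ {t = v} {u = u} r rs) =
  closed-mono (good ls (r ∷ r ∷ rs)) (⊕-monoʳ t (⊕-idem v u))

good-∧L : Good S (((φ ∧′ ψ) ∷ Γ) ▷ Δ) → Good S ((φ ∷ ψ ∷ Γ) ▷ Δ)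
good-∧L good {u = u} (_∷_ {t = v₁} l₁ (_∷_ {t = v₂} {u = t} l₂ ls)) rs =
  closed-mono (good (∧ˡ l₁ l₂ ∷ ls) rs) (⊕-monoˡ u (⊕-assocʳ v₁ v₂ t))

good-∨R : Good S (Γ ▷ ((φ ∨′ ψ) ∷ Δ)) → Good S (Γ ▷ (φ ∷ ψ ∷ Δ))
good-∨R good {t = t} ls (_∷_ {t = v₁} r₁ (_∷_ {t = v₂} {u = u} r₂ rs)) =
  closed-mono (good ls (∨ʳ r₁ r₂ ∷ rs)) (⊕-monoʳ t (⊕-assocʳ v₁ v₂ u))

good-∨L₁ : Good S (((φ ∨′ ψ) ∷ Γ) ▷ Δ) → Good S ((φ ∷ Γ) ▷ Δ)
good-∨L₁ good (l ∷ ls) rs = good (∨ˡ₁ l ∷ ls) rs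

good-∨L₂ : Good S (((φ ∨′ ψ) ∷ Γ) ▷ Δ) → Good S ((ψ ∷ Γ) ▷ Δ)
good-∨L₂ good (l ∷ ls) rs = good (∨ˡ₂ l ∷ ls) rs

good-∧R₁ : Good S (Γ ▷ ((φ ∧′ ψ) ∷ Δ)) → Good S (Γ ▷ (φ ∷ Δ))
good-∧R₁ good ls (r ∷ rs) = good ls (∧ʳ₁ r ∷ rs)

good-∧R₂ : Good S (Γ ▷ ((φ ∧′ ψ) ∷ Δ)) → Good S (Γ ▷ (ψ ∷ Δ))
good-∧R₂ good ls (r ∷ rs) = good ls (∧ʳ₂ r ∷ rs)

good--R : Good S (Γ ▷ ((-′ φ) ∷ Δ)) → Good S ((φ ∷ Γ) ▷ Δ)
good--R good {u = u} (_∷_ {t = v} {u = t} l ls) rs =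
  closed-mono (good ls (-ʳ l ∷ rs)) (⊕-rotate v t u)

good--L : Good S (((-′ φ) ∷ Γ) ▷ Δ) → Good S (Γ ▷ (φ ∷ Δ))
good--L good {t = t} ls (_∷_ {t = v} {u = u} r rs) =
  closed-mono (good (-ˡ r ∷ ls) rs) (⊕-assocʳ v t u ⨾ ⊕-swap v t u)

good-⊤L : Good S ((⊤′ ∷ Γ) ▷ Δ) → Good S (Γ ▷ Δ)
good-⊤L good ls rs = good (⊤ˡ ∷ ls) rs

good-⊥R : Good S (Γ ▷ (⊥′ ∷ Δ)) → Good S (Γ ▷ Δ)
good-⊥R good ls rs = good ls (⊥ʳ ∷ rs)

good-sound : S ⊢[ true ] s → Good S s
good-sound (hyp s∈S)    = derivable⇒good (hyp s∈S)
good-sound (perm p q d) = good-↭ p q (good-sound d)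
good-sound (ident _)    = good-identity
good-sound (cut {Δ = Δ} d₁ d₂) =
  good-cut (good-++-commR Δ [ _ ] (good-sound d₁)) (good-sound d₂)
good-sound (weakL d)    = good-weakL (good-sound d)
good-sound (weakR {Δ = Δ} d) = good-++-commR [ _ ] Δ (good-weakR (good-sound d))
good-sound (contrL d)   = good-contrL (good-sound d)
good-sound (contrR {Δ = Δ} d) =
  good-++-commR [ _ ] Δ (good-contrR (good-++-commR Δ (_ ∷ _ ∷ []) (good-sound d)))
good-sound (∧R-elim₁ {Δ = Δ} d) =
  good-++-commR [ _ ] Δ (good-∧R₁ (good-++-commR Δ [ _ ] (good-sound d)))
good-sound (∧R-elim₂ {Δ = Δ} d) =
  good-++-commR [ _ ] Δ (good-∧R₂ (good-++-commR Δ [ _ ] (good-sound d)))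
good-sound (∧L-elim d)  = good-∧L (good-sound d)
good-sound (∨L-elim₁ d) = good-∨L₁ (good-sound d)
good-sound (∨L-elim₂ d) = good-∨L₂ (good-sound d)
good-sound (∨R-elim {Δ = Δ} d) =
  good-++-commR (_ ∷ _ ∷ []) Δ (good-∨R (good-++-commR Δ [ _ ] (good-sound d)))
good-sound (-R-elim {Δ = Δ} d) = good--R (good-++-commR Δ [ _ ] (good-sound d))
good-sound (-L-elim {Δ = Δ} d) = good-++-commR [ _ ] Δ (good--L (good-sound d))
good-sound (⊤L-elim d)  = good-⊤L (good-sound d)
good-sound (⊥R-elim {Δ = Δ} d) = good-⊥R (good-++-commR Δ [ _ ] (good-sound d))

theorem3p10 : (S : SequentSet) →
    S ⊢[ true ] ([] ▷ []) → S ⊢[ false ] ([] ▷ [])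
theorem3p10 S d with good-sound d [] []
... | inj₁ ⊢∅ = ⊢∅
... | inj₂ (_ , () , _)
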